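{- Let $p\ge q\ge r\ge 0$ be integers with $p+q+r=n-3$. Then (i) if $q\ge 1$, $F(S_{p,q,r}) < F(S_{p+1,q-1,r})$; and (ii) if $r\ge 1$, $F(S_{p,q,r}) < F(S_{p,q+1,r-1})$.
   Context: All graphs are finite and simple. The F-index of a graph $G$ is $F(G)=\sum_{v\in V(G)} d_G(v)^3$. For integers $p,q,r\ge 0$, $S_{p,q,r}$ is the graph obtained from a triangle $xyz$ by attaching $p$ new leaves (vertices adjacent only to $x$) to $x$, $q$ new leaves to $y$ and $r$ new leaves to $z$; it has $p+q+r+3$ vertices. -}

module Defs where

open import Data.Nat using (ℕ; zero; suc; _+_; _*_; _<_; _≤_)
open import Data.Bool using (Bool; true; false; _∧_; _∨_; if_then_else_)
open import Data.Fin using (Fin; toℕ)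
open import Data.List using (List; map; filter; length; allFin)
open import Data.Nat.ListAction using (sum)
open import Relation.Binary.PropositionalEquality using (_≡_)
open import Relation.Nullary.Decidable using (⌊_⌋)
open import Data.Nat using (_≡ᵇ_; _<ᵇ_)

record Graph (n : ℕ) : Set where
  field
    adj   : Fin n → Fin n → Bool
    sym   : ∀ u v → adj u v ≡ adj v u
    irrefl : ∀ v → adj v v ≡ false
open Graph public

degree : ∀ {n} → Graph n → Fin n → ℕ
degree G v = length (filter (λ u → Data.Bool._≟_ (adj G v u) true) (allFin _))

F : ∀ {n} → Graph n → ℕ
F G = sum (map (λ v → degree G v * degree G v * degree G v) (allFin _))

-- S_{p,q,r} on vertex set Fin (p+q+r+3), as ℕ-labels 0..p+q+r+2:
-- 0 = x, 1 = y, 2 = z; labels 3 .. 2+p are leaves at x,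
-- labels 3+p .. 2+p+q are leaves at y, labels 3+p+q .. 2+p+q+r leaves at z.
-- owner i = hub (0,1,2) to which a leaf label i ≥ 3 is attached.
owner : ℕ → ℕ → ℕ → ℕ
owner p q i = if i <ᵇ 3 + p then 0 else (if i <ᵇ 3 + p + q then 1 else 2)

-- one-directional edge relation on labels: triangle edges among hubs,
-- and each leaf i ≥ 3 to its hub owner p q i
E : ℕ → ℕ → ℕ → ℕ → Bool
E p q i j =
  if i <ᵇ 3
  then (if j <ᵇ 3 then Data.Bool.not (i ≡ᵇ j) else false)
  else (if j <ᵇ 3 then owner p q i ≡ᵇ j else false)

mkGraph : (n : ℕ) → (ℕ → ℕ → Bool) → Graph n
mkGraph n R = record
  { adj = λ u v → Data.Bool.not (toℕ u ≡ᵇ toℕ v) ∧ (R (toℕ u) (toℕ v) ∨ R (toℕ v) (toℕ u))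
  ; sym = λ u v → symP u v
  ; irrefl = λ v → irr v }
  where
  open import Relation.Binary.PropositionalEquality using (refl; cong; cong₂)
  open import Data.Bool.Properties using (∨-comm)
  eqᵇ-sym : ∀ a b → (a ≡ᵇ b) ≡ (b ≡ᵇ a)
  eqᵇ-sym zero zero = refl
  eqᵇ-sym zero (suc b) = refl
  eqᵇ-sym (suc a) zero = refl
  eqᵇ-sym (suc a) (suc b) = eqᵇ-sym a b
  eqᵇ-refl : ∀ a → (a ≡ᵇ a) ≡ true
  eqᵇ-refl zero = refl
  eqᵇ-refl (suc a) = eqᵇ-refl a
  symP : ∀ (u v : Fin n) → (Data.Bool.not (toℕ u ≡ᵇ toℕ v) ∧ (R (toℕ u) (toℕ v) ∨ R (toℕ v) (toℕ u)))
                         ≡ (Data.Bool.not (toℕ v ≡ᵇ toℕ u) ∧ (R (toℕ v) (toℕ u) ∨ R (toℕ u) (toℕ v)))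
  symP u v = cong₂ _∧_ (cong Data.Bool.not (eqᵇ-sym (toℕ u) (toℕ v)))
                       (∨-comm (R (toℕ u) (toℕ v)) (R (toℕ v) (toℕ u)))
  irr : ∀ (v : Fin n) → (Data.Bool.not (toℕ v ≡ᵇ toℕ v) ∧ (R (toℕ v) (toℕ v) ∨ R (toℕ v) (toℕ v))) ≡ false
  irr v rewrite eqᵇ-refl (toℕ v) = refl

S : (p q r : ℕ) → Graph (p + q + r + 3)
S p q r = mkGraph (p + q + r + 3) (E p q)

-- The hubs x, y, z of S_{p,q,r} have degrees p + 2, q + 2, r + 2 and every leaf has degree 1,
-- so F(S_{p,q,r}) = (p+2)³ + (q+2)³ + (r+2)³ + (p+q+r). Moving a leaf from hub v to hub u thus
-- changes F by ((d_u+1)³ - d_u³) - (d_v³ - (d_v-1)³) = 3 (d_u + d_v)(d_u - d_v + 1), which is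
-- positive as soon as d_v ≤ d_u: strict convexity of the cube.
module Submission where

open import Defs hiding (sym)
open import Data.Bool using (Bool; true; false; not; _∧_; _∨_; if_then_else_)
open import Data.Bool.Properties using (T-≡; ¬-not; ∨-identityʳ; ∧-zeroʳ)
import Data.Bool as Bool
open import Data.Fin using (Fin; toℕ) renaming (zero to fzero; suc to fsuc)
open import Data.List using ([]; _∷_; map; filter; length; allFin; tabulate)
open import Data.List.Properties using (map-tabulate)
open import Data.Nat using (ℕ; zero; suc; _+_; _*_; _<_; _≤_; _≥_; z≤n; s≤s; _<ᵇ_; _≡ᵇ_)
open import Data.Nat.ListAction using (sum)
open import Data.Nat.Properties
  using (+-comm; +-assoc; +-suc; *-identityʳ; *-zeroʳ; +-monoʳ-<; +-monoˡ-<;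
         m<m+n; m≤m+n; ≤-trans; <⇒≢; <⇒≱; <ᵇ⇒<; <⇒<ᵇ; ≡ᵇ⇒≡; m≤n⇒∃[o]m+o≡n; module ≤-Reasoning)
open import Data.Nat.Tactic.RingSolver using (solve-∀)
open import Data.Product using (_×_; _,_)
open import Function using (_∘_; id; Equivalence)
open import Relation.Binary.PropositionalEquality
  using (_≡_; refl; sym; trans; cong; cong₂; subst; module ≡-Reasoning)

sumBelow : ℕ → (ℕ → ℕ) → ℕ
sumBelow zero    f = 0
sumBelow (suc n) f = f 0 + sumBelow n (f ∘ suc)

sumBelow-+ : ∀ m n f → sumBelow (m + n) f ≡ sumBelow m f + sumBelow n (λ i → f (m + i))
sumBelow-+ zero    n f = refl
sumBelow-+ (suc m) n f = trans (cong (f 0 +_) (sumBelow-+ m n (f ∘ suc))) (sym (+-assoc (f 0) _ _))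

sumBelow-cong : ∀ n {f g} → (∀ i → i < n → f i ≡ g i) → sumBelow n f ≡ sumBelow n g
sumBelow-cong zero    f≗g = refl
sumBelow-cong (suc n) f≗g =
  cong₂ _+_ (f≗g 0 (s≤s z≤n)) (sumBelow-cong n (λ i i<n → f≗g (suc i) (s≤s i<n)))

sumBelow-const : ∀ n c → sumBelow n (λ _ → c) ≡ n * c
sumBelow-const zero    c = refl
sumBelow-const (suc n) c = cong (c +_) (sumBelow-const n c)

sum-map-allFin : ∀ n (f : Fin n → ℕ) (g : ℕ → ℕ) → (∀ i → f i ≡ g (toℕ i)) →
                 sum (map f (allFin n)) ≡ sumBelow n g
sum-map-allFin zero    f g f≗g = refl
sum-map-allFin (suc n) f g f≗g = cong₂ _+_ (f≗g fzero) (begin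
  sum (map f (tabulate fsuc))     ≡⟨ cong sum (map-tabulate fsuc f) ⟩
  sum (tabulate (f ∘ fsuc))       ≡⟨ cong sum (map-tabulate id (f ∘ fsuc)) ⟨
  sum (map (f ∘ fsuc) (allFin n)) ≡⟨ sum-map-allFin n (f ∘ fsuc) (g ∘ suc) (f≗g ∘ fsuc) ⟩
  sumBelow n (g ∘ suc)            ∎)
  where open ≡-Reasoning

indicator : Bool → ℕ
indicator b = if b then 1 else 0

length-filter-true : ∀ {A : Set} (P : A → Bool) xs →
                     length (filter (λ x → P x Bool.≟ true) xs) ≡ sum (map (indicator ∘ P) xs)
length-filter-true P []       = refl
length-filter-true P (x ∷ xs) with P x
... | true  = cong suc (length-filter-true P xs)
... | false = length-filter-true P xs

sumBelow-indicator-≡ᵇ : ∀ {o n} → o < n → sumBelow n (λ j → indicator (o ≡ᵇ j)) ≡ 1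
sumBelow-indicator-≡ᵇ {zero}  {suc n} _         = cong suc (trans (sumBelow-const n 0) (*-zeroʳ n))
sumBelow-indicator-≡ᵇ {suc o} {suc n} (s≤s o<n) = sumBelow-indicator-≡ᵇ o<n

<ᵇ-true : ∀ {m n} → m < n → (m <ᵇ n) ≡ true
<ᵇ-true m<n = Equivalence.to T-≡ (<⇒<ᵇ m<n)

<ᵇ-false : ∀ {m n} → n ≤ m → (m <ᵇ n) ≡ false
<ᵇ-false n≤m = ¬-not (λ eq → <⇒≱ (<ᵇ⇒< _ _ (Equivalence.from T-≡ eq)) n≤m)

<⇒≡ᵇ-false : ∀ {m n} → m < n → (m ≡ᵇ n) ≡ false
<⇒≡ᵇ-false {m} {n} m<n = ¬-not (<⇒≢ m<n ∘ ≡ᵇ⇒≡ m n ∘ Equivalence.from T-≡)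

cube : ℕ → ℕ
cube x = x * x * x

cube-transfer : ∀ {x y} → x < y → cube y + cube (suc x) < cube (suc y) + cube x
cube-transfer {x} {y} x<y with d , refl ← m≤n⇒∃[o]m+o≡n x<y =
  subst (cube y + cube (suc x) <_) (sym (gap x d)) (m<m+n _ (s≤s z≤n))
  where
  gap : ∀ x d → let y = suc x + d in
        suc y * suc y * suc y + x * x * x ≡ y * y * y + suc x * suc x * suc x + 3 * (suc d * (2 + x + x + d))
  gap = solve-∀

owner<3 : ∀ p q i → owner p q i < 3
owner<3 p q i with i <ᵇ 3 + p
... | true  = s≤s z≤n
... | false with i <ᵇ 3 + p + q
...   | true  = s≤s (s≤s z≤n)
...   | false = s≤s (s≤s (s≤s z≤n))

owner-x : ∀ p q {i} → i < p → owner p q (3 + i) ≡ 0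
owner-x p q i<p rewrite <ᵇ-true i<p = refl

owner-y : ∀ p q {i} → p ≤ i → i < p + q → owner p q (3 + i) ≡ 1
owner-y p q p≤i i<p+q rewrite <ᵇ-false p≤i | <ᵇ-true i<p+q = refl

owner-z : ∀ p q {i} → p + q ≤ i → owner p q (3 + i) ≡ 2
owner-z p q p+q≤i rewrite <ᵇ-false (≤-trans (m≤m+n p q) p+q≤i) | <ᵇ-false p+q≤i = refl

S-adj : ℕ → ℕ → ℕ → ℕ → Bool
S-adj p q i j = not (i ≡ᵇ j) ∧ (E p q i j ∨ E p q j i)

labelDegree : ℕ → ℕ → ℕ → ℕ → ℕ
labelDegree p q n i = sumBelow n (indicator ∘ S-adj p q i)

degree-S : ∀ p q r (v : Fin (p + q + r + 3)) →
           degree (S p q r) v ≡ labelDegree p q (3 + (p + q + r)) (toℕ v)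
degree-S p q r v = begin
  degree (S p q r) v
    ≡⟨ length-filter-true (adj (S p q r) v) (allFin N) ⟩
  sum (map (indicator ∘ adj (S p q r) v) (allFin N))
    ≡⟨ sum-map-allFin N _ _ (λ _ → refl) ⟩
  labelDegree p q N (toℕ v)
    ≡⟨ cong (λ n → labelDegree p q n (toℕ v)) (+-comm (p + q + r) 3) ⟩
  labelDegree p q (3 + (p + q + r)) (toℕ v) ∎
  where
  open ≡-Reasoning
  N = p + q + r + 3

F-S-labels : ∀ p q r → let n = 3 + (p + q + r) in F (S p q r) ≡ sumBelow n (cube ∘ labelDegree p q n)
F-S-labels p q r =
  trans (sum-map-allFin (p + q + r + 3) _ g (cong cube ∘ degree-S p q r))
        (cong (λ n → sumBelow n g) (+-comm (p + q + r) 3))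
  where g = cube ∘ labelDegree p q (3 + (p + q + r))

leaf-adjacency : ∀ p q k j → S-adj p q (3 + k) j ≡ (owner p q (3 + k) ≡ᵇ j)
leaf-adjacency p q k 0 = ∨-identityʳ _
leaf-adjacency p q k 1 = ∨-identityʳ _
leaf-adjacency p q k 2 = ∨-identityʳ _
leaf-adjacency p q k (suc (suc (suc j))) =
  trans (∧-zeroʳ _) (sym (<⇒≡ᵇ-false (≤-trans (owner<3 p q (3 + k)) (m≤m+n 3 j))))

leaf-degree : ∀ p q k {n} → 3 ≤ n → labelDegree p q n (3 + k) ≡ 1
leaf-degree p q k {n} 3≤n =
  trans (sumBelow-cong n (λ j _ → cong indicator (leaf-adjacency p q k j)))
        (sumBelow-indicator-≡ᵇ (≤-trans (owner<3 p q (3 + k)) 3≤n))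

leaves-owned : ∀ p q r h →
  sumBelow (p + q + r) (λ j → indicator (owner p q (3 + j) ≡ᵇ h))
  ≡ p * indicator (0 ≡ᵇ h) + q * indicator (1 ≡ᵇ h) + r * indicator (2 ≡ᵇ h)
leaves-owned p q r h = begin
  sumBelow (p + q + r) f
    ≡⟨ sumBelow-+ (p + q) r f ⟩
  sumBelow (p + q) f + sumBelow r (λ i → f (p + q + i))
    ≡⟨ cong (_+ sumBelow r (λ i → f (p + q + i))) (sumBelow-+ p q f) ⟩
  sumBelow p f + sumBelow q (λ i → f (p + i)) + sumBelow r (λ i → f (p + q + i))
    ≡⟨ cong₂ _+_ (cong₂ _+_ (block p id (owner-x p q))
                            (block q (p +_) (λ i<q → owner-y p q (m≤m+n p _) (+-monoʳ-< p i<q))))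
                 (block r (p + q +_) (λ _ → owner-z p q (m≤m+n (p + q) _))) ⟩
  p * indicator (0 ≡ᵇ h) + q * indicator (1 ≡ᵇ h) + r * indicator (2 ≡ᵇ h) ∎
  where
  open ≡-Reasoning
  f : ℕ → ℕ
  f j = indicator (owner p q (3 + j) ≡ᵇ h)
  block : ∀ n g {o} → (∀ {i} → i < n → owner p q (3 + g i) ≡ o) → sumBelow n (f ∘ g) ≡ n * indicator (o ≡ᵇ h)
  block n g owned =
    trans (sumBelow-cong n (λ i i<n → cong (λ o → indicator (o ≡ᵇ h)) (owned i<n))) (sumBelow-const n _)

hub-degrees : ∀ p q r → let d = labelDegree p q (3 + (p + q + r)) in
              d 0 ≡ 2 + p × d 1 ≡ 2 + q × d 2 ≡ 2 + r
hub-degrees p q r = cong (2 +_) (trans (leaves-owned p q r 0) (only-x p q r))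
                  , cong (2 +_) (trans (leaves-owned p q r 1) (only-y p q r))
                  , cong (2 +_) (trans (leaves-owned p q r 2) (only-z p q r))
  where
  only-x : ∀ p q r → p * 1 + q * 0 + r * 0 ≡ p
  only-x = solve-∀
  only-y : ∀ p q r → p * 0 + q * 1 + r * 0 ≡ q
  only-y = solve-∀
  only-z : ∀ p q r → p * 0 + q * 0 + r * 1 ≡ r
  only-z = solve-∀

F-S : ∀ p q r → F (S p q r) ≡ cube (2 + p) + cube (2 + q) + cube (2 + r) + (p + q + r)
F-S p q r with dx , dy , dz ← hub-degrees p q r = begin
  F (S p q r)
    ≡⟨ F-S-labels p q r ⟩
  cube (d 0) + (cube (d 1) + (cube (d 2) + sumBelow m (cube ∘ d ∘ (3 +_))))
    ≡⟨ cong₂ _+_ (cong cube dx) (cong₂ _+_ (cong cube dy) (cong₂ _+_ (cong cube dz) leaves)) ⟩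
  a + (b + (c + m))
    ≡⟨ trans (+-assoc (a + b) c m) (+-assoc a b (c + m)) ⟨
  a + b + c + m ∎
  where
  open ≡-Reasoning
  m = p + q + r
  d = labelDegree p q (3 + m)
  a = cube (2 + p)
  b = cube (2 + q)
  c = cube (2 + r)
  leaves : sumBelow m (cube ∘ d ∘ (3 +_)) ≡ m
  leaves = trans (sumBelow-cong m (λ k _ → cong cube (leaf-degree p q k (m≤m+n 3 m))))
                 (trans (sumBelow-const m 1) (*-identityʳ m))

F-S-move-y-to-x : ∀ {p q} r → q < p → F (S p (suc q) r) < F (S (suc p) q r)
F-S-move-y-to-x {p} {q} r q<p = begin-strict
  F (S p (suc q) r)
    ≡⟨ F-S p (suc q) r ⟩
  cube (2 + p) + cube (3 + q) + cube (2 + r) + (p + suc q + r)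
    ≡⟨ cong (λ l → cube (2 + p) + cube (3 + q) + cube (2 + r) + (l + r)) (+-suc p q) ⟩
  cube (2 + p) + cube (3 + q) + cube (2 + r) + (suc p + q + r)
    <⟨ +-monoˡ-< _ (+-monoˡ-< _ (cube-transfer (+-monoʳ-< 2 q<p))) ⟩
  cube (3 + p) + cube (2 + q) + cube (2 + r) + (suc p + q + r)
    ≡⟨ F-S (suc p) q r ⟨
  F (S (suc p) q r) ∎
  where open ≤-Reasoning

F-S-move-z-to-y : ∀ p {q r} → r < q → F (S p q (suc r)) < F (S p (suc q) r)
F-S-move-z-to-y p {q} {r} r<q = begin-strict
  F (S p q (suc r))
    ≡⟨ F-S p q (suc r) ⟩
  a + cube (2 + q) + cube (3 + r) + (p + q + suc r)
    ≡⟨ cong₂ _+_ (+-assoc a _ _) (trans (+-suc (p + q) r) (cong (_+ r) (sym (+-suc p q)))) ⟩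
  a + (cube (2 + q) + cube (3 + r)) + (p + suc q + r)
    <⟨ +-monoˡ-< _ (+-monoʳ-< a (cube-transfer (+-monoʳ-< 2 r<q))) ⟩
  a + (cube (3 + q) + cube (2 + r)) + (p + suc q + r)
    ≡⟨ cong (_+ (p + suc q + r)) (+-assoc a _ _) ⟨
  a + cube (3 + q) + cube (2 + r) + (p + suc q + r)
    ≡⟨ F-S p (suc q) r ⟨
  F (S p (suc q) r) ∎
  where
  open ≤-Reasoning
  a = cube (2 + p)

theorem3 : ∀ (n p q r : ℕ) → p ≥ q → q ≥ r → p + q + r + 3 ≡ n →
    (∀ q' → q ≡ suc q' → F (S p q r) < F (S (suc p) q' r))
    × (∀ r' → r ≡ suc r' → F (S p q r) < F (S p (suc q) r'))
theorem3 n p q r p≥q q≥r _ = (λ { _ refl → F-S-move-y-to-x r p≥q })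
                           , (λ { _ refl → F-S-move-z-to-y p q≥r })
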